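{- Let $G=(V,E)$ be a finite simple graph. Let $\kappa(G)$ be the number of vertices of $G$ not contained in any cycle of $G$, and $\tau(G)$ the maximum number of pairwise vertex-disjoint cycles of $G$. Then \[\mathrm{girth}(G)-1+\kappa(G)\leq i_{cy}(G)\leq \beta_{cy}(G)\leq |V|-\tau(G),\] where $\mathrm{girth}(G)$ is set to $1$ if $G$ is acyclic, and is the length of a shortest cycle of $G$ otherwise.
   Context: For $S\subseteq V$, $\langle S\rangle$ denotes the induced subgraph. A set $S\subseteq V$ is cycle independent if $\langle S\rangle$ is acyclic. $\beta_{cy}(G)$ is the maximum size of a cycle independent set; $i_{cy}(G)$ is the minimum size of a cycle independent set that is maximal with respect to inclusion. -}

module Defs where

open import Data.Nat using (ℕ; suc; _≤_; _∸_; _+_)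
open import Data.Bool using (Bool; true; false)
open import Data.Fin using (Fin)
open import Data.Fin.Subset using (Subset; _∈_; _∉_; _⊆_; ∣_∣)
open import Data.List using (List; []; _∷_; _++_; length)
open import Data.List.Relation.Unary.All using (All)
open import Data.List.Relation.Unary.Unique.Propositional using (Unique)
open import Data.List.Relation.Unary.Linked using (Linked)
open import Data.List.Relation.Unary.AllPairs using (AllPairs)
import Data.List.Membership.Propositional as LM
open import Data.Product using (Σ; _×_; ∃-syntax)
open import Data.Sum using (_⊎_)
open import Data.Empty using (⊥)
open import Relation.Nullary using (¬_)
open import Relation.Binary.PropositionalEquality using (_≡_)

record Graph (n : ℕ) : Set where
  field
    adj    : Fin n → Fin n → Bool
    sym    : ∀ i j → adj i j ≡ adj j i
    irrefl : ∀ i → adj i i ≡ false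

open Graph public

Adj : ∀ {n} → Graph n → Fin n → Fin n → Set
Adj G i j = adj G i j ≡ true

-- A cycle v₀ v₁ … v_{k-1} (k ≥ 3): distinct vertices, v_j ~ v_{j+1}, v_{k-1} ~ v₀.
record Cycle {n : ℕ} (G : Graph n) : Set where
  field
    start    : Fin n
    rest     : List (Fin n)
    long     : 2 ≤ length rest
    distinct : Unique (start ∷ rest)
    closed   : Linked (Adj G) (start ∷ rest ++ start ∷ [])

  verts : List (Fin n)
  verts = start ∷ rest

  len : ℕ
  len = length verts

open Cycle public

OnCycle : ∀ {n} {G : Graph n} → Fin n → Cycle G → Set
OnCycle v C = v LM.∈ verts C

Acyclic : ∀ {n} → Graph n → Set
Acyclic G = ¬ Cycle G

-- The cycles of the induced subgraph ⟨S⟩ are exactly the cycles of G all of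
-- whose vertices lie in S; ⟨S⟩ acyclic means there is no such cycle.
CycleIndependent : ∀ {n} → Graph n → Subset n → Set
CycleIndependent G S = ¬ (Σ (Cycle G) λ C → All (_∈ S) (verts C))

MaximalCycleIndependent : ∀ {n} → Graph n → Subset n → Set
MaximalCycleIndependent G S =
  CycleIndependent G S × (∀ T → S ⊆ T → CycleIndependent G T → T ⊆ S)

IsBetaCy : ∀ {n} → Graph n → ℕ → Set
IsBetaCy G b =
  (Σ _ λ S → CycleIndependent G S × ∣ S ∣ ≡ b) ×
  (∀ S → CycleIndependent G S → ∣ S ∣ ≤ b)

IsICy : ∀ {n} → Graph n → ℕ → Set
IsICy G i =
  (Σ _ λ S → MaximalCycleIndependent G S × ∣ S ∣ ≡ i) ×
  (∀ S → MaximalCycleIndependent G S → i ≤ ∣ S ∣)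

IsKappa : ∀ {n} → Graph n → ℕ → Set
IsKappa {n} G k =
  Σ (Subset n) λ S →
    (∀ v → (v ∈ S → ¬ (Σ (Cycle G) (OnCycle v))) × (¬ (Σ (Cycle G) (OnCycle v)) → v ∈ S)) ×
    ∣ S ∣ ≡ k

VertexDisjoint : ∀ {n} {G : Graph n} → Cycle G → Cycle G → Set
VertexDisjoint {n} C D = ∀ (v : Fin n) → OnCycle v C → OnCycle v D → ⊥

IsTau : ∀ {n} → Graph n → ℕ → Set
IsTau G t =
  (Σ (List (Cycle G)) λ Cs → AllPairs VertexDisjoint Cs × length Cs ≡ t) ×
  (∀ (Cs : List (Cycle G)) → AllPairs VertexDisjoint Cs → length Cs ≤ t)

IsGirth : ∀ {n} → Graph n → ℕ → Set
IsGirth G g =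
  (Acyclic G × g ≡ 1) ⊎
  ((Σ (Cycle G) λ C → len C ≡ g) × (∀ (C : Cycle G) → g ≤ len C))

-- Every quantity in the chain is an extremum of a decidable predicate over finite data (a cycle
-- is determined by its vertex list, of length at most n), so all of them exist constructively.
--
-- β + τ ≤ n: each cycle of a packing has a vertex outside a cycle-independent set S; these
-- vertices are distinct, so adding them to S one at a time never leaves V.
--
-- girth − 1 + κ ≤ |S| for maximal S: an acyclic vertex can be added to any cycle-independent set,
-- so all κ of them lie in S. A shortest cycle has a vertex v ∉ S, and by maximality S ∪ {v}
-- contains a cycle C. Its vertices are in S ∪ {v} and not acyclic, so κ + girth ≤ κ + |C| ≤ |S| + 1.
module Submission where

open import Defs hiding (sym)
open import Data.Nat using (ℕ; zero; suc; _≤_; _<_; _∸_; _+_; z≤n; s≤s; s≤s⁻¹; _≤?_)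
open import Data.Nat.Properties
  using (≤-trans; ≤⇒≯; ≮⇒≥; n≤1+n; n≤0⇒n≡0; ≤∧≢⇒<; anyUpTo?; suc-injective; +-comm; +-suc; +-identityʳ;
         +-monoˡ-≤; +-monoʳ-≤; ∸-monoˡ-≤; m+n≤o⇒m≤o∸n; module ≤-Reasoning)
  renaming (_≟_ to _≟ℕ_)
open import Data.Bool using (true) renaming (_≟_ to _≟𝔹_)
open import Data.Unit using (⊤; tt)
open import Data.Product using (Σ; _×_; _,_; ∃; ∃-syntax)
open import Data.Sum using (_⊎_; inj₁; inj₂; [_,_]′)
open import Data.Vec using ([]; _∷_; tabulate)
open import Data.Vec.Properties using (lookup∘tabulate; []=⇒lookup; lookup⇒[]=)
open import Data.Fin using (Fin) renaming (_≟_ to _≟F_)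
open import Data.Fin.Properties using (all?; any?)
open import Data.Fin.Subset
  using (Subset; inside; outside; _∈_; _∉_; _⊆_; _∪_; _-_; ⁅_⁆; ∣_∣) renaming (⊥ to ∅)
open import Data.Fin.Subset.Properties
  using (_∈?_; _⊆?_; anySubset?; ∉⊥; ∈⊤; ∣⊥∣≡0; ∣⊤∣≡n; ∣p∣≤n; ∣⁅x⁆∣≡1; x∈⁅x⁆; x∈⁅y⁆⇒x≡y;
         p⊆p∪q; x∈p∪q⁺; x∈p∪q⁻; p⊆q⇒∣p∣≤∣q∣; p⊂q⇒∣p∣<∣q∣; x∈p∧x≢y⇒x∈p-y; x∈p⇒∣p-x∣<∣p∣)
open import Data.List using (List; []; _∷_; _++_; length; map)
open import Data.List.Relation.Unary.All as All using (All; []; _∷_)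
open import Data.List.Relation.Unary.All.Properties using (¬All⇒Any¬)
open import Data.List.Relation.Unary.AllPairs using (AllPairs; []; _∷_; allPairs?)
open import Data.List.Relation.Unary.AllPairs.Properties using (map⁺; map⁻)
open import Data.List.Relation.Unary.Linked using (Linked; linked?)
open import Data.List.Relation.Unary.Unique.Propositional using (Unique)
open import Data.List.Membership.Propositional using (find) renaming (_∈_ to _∈ₗ_; _∉_ to _∉ₗ_)
open import Data.Empty using (⊥)
open import Relation.Nullary using (Dec; yes; no; contradiction)
open import Relation.Nullary.Decidable using (map′; does; dec-true; ¬?; _×-dec_; _⊎-dec_; _→-dec_; decidable-stable)
open import Function using (_∘_)
open import Relation.Unary using (Decidable)
open import Induction.WellFounded using (Acc; acc)
open import Data.Nat.Induction using (<-wellFounded)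
open import Relation.Binary.PropositionalEquality using (_≡_; refl; sym; trans; cong; subst; subst₂)

module _ {P : ℕ → Set} (P? : Decidable P) where

  least : ∀ {a} → P a → ∃[ m ] P m × (∀ {k} → P k → m ≤ k)
  least {a} = go (<-wellFounded a)
    where
    go : ∀ {j} → Acc _<_ j → P j → ∃[ m ] P m × (∀ {k} → P k → m ≤ k)
    go {j} (acc smaller) pj with anyUpTo? P? j
    ... | yes (k , k<j , pk) = go (smaller k<j) pk
    ... | no ∄k = j , pj , λ pk → ≮⇒≥ (λ k<j → ∄k (_ , k<j , pk))

  greatest : ∀ {a} b → (∀ {k} → P k → k ≤ b) → P a → ∃[ m ] P m × (∀ {k} → P k → k ≤ m)
  greatest b bounded pa with P? b
  ... | yes pb = b , pb , bounded
  greatest zero bounded pa | no ¬p0 = contradiction (subst P (n≤0⇒n≡0 (bounded pa)) pa) ¬p0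
  greatest (suc b) bounded pa | no ¬pb = greatest b (λ pk → s≤s⁻¹ (below pk)) pa
    where
    below : ∀ {k} → P k → k < suc b
    below {k} pk = ≤∧≢⇒< (bounded pk) (λ { refl → ¬pb pk })

∣p∪q∣≤∣p∣+∣q∣ : ∀ {n} (p q : Subset n) → ∣ p ∪ q ∣ ≤ ∣ p ∣ + ∣ q ∣
∣p∪q∣≤∣p∣+∣q∣ []            []            = z≤n
∣p∪q∣≤∣p∣+∣q∣ (outside ∷ p) (outside ∷ q) = ∣p∪q∣≤∣p∣+∣q∣ p q
∣p∪q∣≤∣p∣+∣q∣ (outside ∷ p) (inside ∷ q)  = subst (suc ∣ p ∪ q ∣ ≤_) (sym (+-suc ∣ p ∣ ∣ q ∣)) (s≤s (∣p∪q∣≤∣p∣+∣q∣ p q))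
∣p∪q∣≤∣p∣+∣q∣ (inside ∷ p)  (outside ∷ q) = s≤s (∣p∪q∣≤∣p∣+∣q∣ p q)
∣p∪q∣≤∣p∣+∣q∣ (inside ∷ p)  (inside ∷ q)  = s≤s (≤-trans (∣p∪q∣≤∣p∣+∣q∣ p q) (+-monoʳ-≤ ∣ p ∣ (n≤1+n ∣ q ∣)))

∣p∪⁅x⁆∣≤1+∣p∣ : ∀ {n} (p : Subset n) x → ∣ p ∪ ⁅ x ⁆ ∣ ≤ suc ∣ p ∣
∣p∪⁅x⁆∣≤1+∣p∣ p x = subst (∣ p ∪ ⁅ x ⁆ ∣ ≤_) (trans (cong (∣ p ∣ +_) (∣⁅x⁆∣≡1 x)) (+-comm ∣ p ∣ 1)) (∣p∪q∣≤∣p∣+∣q∣ p ⁅ x ⁆)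

x∉p⇒∣p∣<∣p∪⁅x⁆∣ : ∀ {n} {p : Subset n} {x} → x ∉ p → ∣ p ∣ < ∣ p ∪ ⁅ x ⁆ ∣
x∉p⇒∣p∣<∣p∪⁅x⁆∣ {x = x} x∉p = p⊂q⇒∣p∣<∣q∣ (p⊆p∪q ⁅ x ⁆ , x , x∈p∪q⁺ (inj₂ (x∈⁅x⁆ x)) , x∉p)

p⊆q∧∣q∣≤∣p∣⇒q⊆p : ∀ {n} {p q : Subset n} → p ⊆ q → ∣ q ∣ ≤ ∣ p ∣ → q ⊆ p
p⊆q∧∣q∣≤∣p∣⇒q⊆p {p = p} p⊆q ∣q∣≤∣p∣ {x} x∈q with x ∈? p
... | yes x∈p = x∈p
... | no  x∉p = contradiction (p⊂q⇒∣p∣<∣q∣ (p⊆q , x , x∈q , x∉p)) (≤⇒≯ ∣q∣≤∣p∣)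

All-∈p∪⁅x⁆⇒All-∈p : ∀ {n} {p : Subset n} {x} {xs : List (Fin n)} → x ∉ₗ xs → All (_∈ p ∪ ⁅ x ⁆) xs → All (_∈ p) xs
All-∈p∪⁅x⁆⇒All-∈p {p = p} {x} {xs} x∉xs xs⊆p∪x = All.tabulate λ {y} y∈xs →
  [ (λ y∈p → y∈p) , (λ y∈⁅x⁆ → contradiction (subst (_∈ₗ xs) (x∈⁅y⁆⇒x≡y x y∈⁅x⁆) y∈xs) x∉xs) ]′
    (x∈p∪q⁻ p ⁅ x ⁆ (All.lookup xs⊆p∪x y∈xs))

unique-count : ∀ {n} {k p : Subset n} {xs : List (Fin n)} →
               k ⊆ p → Unique xs → All (_∈ p) xs → All (_∉ k) xs → ∣ k ∣ + length xs ≤ ∣ p ∣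
unique-count {k = k} k⊆p [] [] [] = subst (_≤ _) (sym (+-identityʳ ∣ k ∣)) (p⊆q⇒∣p∣≤∣q∣ k⊆p)
unique-count {k = k} {p} {x ∷ xs} k⊆p (x∉xs ∷ xs!) (x∈p ∷ xs⊆p) (x∉k ∷ xs∉k) = begin
  ∣ k ∣ + suc (length xs) ≡⟨ +-suc ∣ k ∣ (length xs) ⟩
  suc (∣ k ∣ + length xs) ≤⟨ s≤s (unique-count k⊆p-x xs! xs⊆p-x xs∉k) ⟩
  suc ∣ p - x ∣           ≤⟨ x∈p⇒∣p-x∣<∣p∣ x∈p ⟩
  ∣ p ∣                   ∎
  where
  open ≤-Reasoning
  k⊆p-x : k ⊆ p - x
  k⊆p-x {y} y∈k = x∈p∧x≢y⇒x∈p-y (k⊆p y∈k) λ { refl → x∉k y∈k }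
  xs⊆p-x : All (_∈ p - x) xs
  xs⊆p-x = All.zipWith (λ (x≢y , y∈p) → x∈p∧x≢y⇒x∈p-y y∈p (x≢y ∘ sym)) (x∉xs , xs⊆p)

unique⇒length≤n : ∀ {n} {xs : List (Fin n)} → Unique xs → length xs ≤ n
unique⇒length≤n {n} {xs} xs! = subst₂ _≤_ (cong (_+ length xs) (∣⊥∣≡0 n)) (∣⊤∣≡n n)
  (unique-count (λ x∈∅ → contradiction x∈∅ ∉⊥) xs! (All.tabulate λ _ → ∈⊤) (All.tabulate λ _ → ∉⊥))

module _ {n} {P : Fin n → Set} (P? : Decidable P) where

  subsetOf : Subset n
  subsetOf = tabulate (λ x → does (P? x))

  ∈-subsetOf⁺ : ∀ {x} → P x → x ∈ subsetOf
  ∈-subsetOf⁺ {x} px = lookup⇒[]= x subsetOf (trans (lookup∘tabulate _ x) (dec-true (P? x) px))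

  ∈-subsetOf⁻ : ∀ {x} → x ∈ subsetOf → P x
  ∈-subsetOf⁻ {x} x∈ with P? x | trans (sym (lookup∘tabulate _ x)) ([]=⇒lookup x∈)
  ... | yes px | _  = px
  ... | no  _  | ()

module _ {n} {P : Subset n → Set} (P? : Decidable P) where

  allSubset? : Dec (∀ p → P p)
  allSubset? = map′ (λ ∄¬P p → decidable-stable (P? p) (λ ¬Pp → ∄¬P (p , ¬Pp)))
                    (λ ∀P (p , ¬Pp) → ¬Pp (∀P p))
                    (¬? (anySubset? (¬? ∘ P?)))

  minimumSize : ∃ P → ∃[ p ] P p × (∀ q → P q → ∣ p ∣ ≤ ∣ q ∣)
  minimumSize (p , Pp) with least (λ k → anySubset? (λ q → P? q ×-dec ∣ q ∣ ≟ℕ k)) (p , Pp , refl)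
  ... | _ , (q , Pq , refl) , min = q , Pq , λ r Pr → min (r , Pr , refl)

  maximumSize : ∃ P → ∃[ p ] P p × (∀ q → P q → ∣ q ∣ ≤ ∣ p ∣)
  maximumSize (p , Pp) with greatest (λ k → anySubset? (λ q → P? q ×-dec ∣ q ∣ ≟ℕ k)) n
                                     (λ { (q , _ , refl) → ∣p∣≤n q }) (p , Pp , refl)
  ... | _ , (q , Pq , refl) , max = q , Pq , λ r Pr → max (r , Pr , refl)

anyList? : ∀ {n} {P : List (Fin n) → Set} → Decidable P → ∀ k → Dec (∃[ xs ] length xs ≤ k × P xs)
anyList? P? zero = map′ (λ p → [] , z≤n , p) (λ { ([] , _ , p) → p }) (P? [])
anyList? {P = P} P? (suc k) = map′ to from (P? [] ⊎-dec any? (λ x → anyList? (P? ∘ (x ∷_)) k))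
  where
  to : P [] ⊎ ∃[ x ] ∃[ xs ] length xs ≤ k × P (x ∷ xs) → ∃[ xs ] length xs ≤ suc k × P xs
  to = [ (λ p → [] , z≤n , p) , (λ (x , xs , l , p) → x ∷ xs , s≤s l , p) ]′
  from : ∃[ xs ] length xs ≤ suc k × P xs → P [] ⊎ ∃[ x ] ∃[ xs ] length xs ≤ k × P (x ∷ xs)
  from ([] , _ , p)            = inj₁ p
  from (x ∷ xs , s≤s l , p) = inj₂ (x , xs , l , p)

module _ {n} (G : Graph n) where

  open import Data.List.Relation.Unary.Unique.DecPropositional (_≟F_ {n}) using (unique?)
  open import Data.List.Membership.DecPropositional (_≟F_ {n}) using () renaming (_∈?_ to _∈ₗ?_)

  private
    cycle-fields : ∀ {s r} → (∃[ C ] verts {G = G} C ≡ s ∷ r) →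
                   2 ≤ length r × Unique (s ∷ r) × Linked (Adj G) (s ∷ r ++ s ∷ [])
    cycle-fields (C , refl) = long C , distinct C , closed C

  cycle? : (xs : List (Fin n)) → Dec (∃[ C ] verts {G = G} C ≡ xs)
  cycle? []      = no λ ()
  cycle? (s ∷ r) = map′ (λ (l , u , c) → mkCycle l u c , refl) cycle-fields
    (2 ≤? length r ×-dec unique? (s ∷ r) ×-dec linked? (λ i j → adj G i j ≟𝔹 true) (s ∷ r ++ s ∷ []))
    where
    mkCycle : 2 ≤ length r → Unique (s ∷ r) → Linked (Adj G) (s ∷ r ++ s ∷ []) → Cycle G
    mkCycle l u c = record { start = s ; rest = r ; long = l ; distinct = u ; closed = c }

  -- Searches are over vertex lists: a cycle is determined by its vertex list only up to its
  -- proof fields, so predicates are taken on verts C rather than on C.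
  anyCycle? : ∀ {P : List (Fin n) → Set} → Decidable P → Dec (∃[ C ] P (verts C))
  anyCycle? {P} P? =
    map′ (λ { (_ , _ , (C , refl) , p) → C , p }) (λ (C , p) → verts C , unique⇒length≤n (distinct C) , (C , refl) , p)
         (anyList? (λ xs → cycle? xs ×-dec P? xs) n)

  anyCycles? : ∀ k {P : List (List (Fin n)) → Set} → Decidable P →
               Dec (∃[ Cs ] P (map (verts {G = G}) Cs) × length Cs ≡ k)
  anyCycles? zero    P? = map′ (λ p → [] , p , refl) (λ { ([] , p , refl) → p }) (P? [])
  anyCycles? (suc k) P? = map′ (λ (C , Cs , p , l) → C ∷ Cs , p , cong suc l)
                               (λ { (C ∷ Cs , p , l) → C , Cs , p , suc-injective l })
                               (anyCycle? (λ xs → anyCycles? k (P? ∘ (xs ∷_))))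

  onCycle? : ∀ v → Dec (Σ (Cycle G) (OnCycle v))
  onCycle? v = anyCycle? (v ∈ₗ?_)

  cycleIndependent? : ∀ S → Dec (CycleIndependent G S)
  cycleIndependent? S = ¬? (anyCycle? (All.all? (_∈? S)))

  maximalCycleIndependent? : ∀ S → Dec (MaximalCycleIndependent G S)
  maximalCycleIndependent? S =
    cycleIndependent? S ×-dec allSubset? (λ T → S ⊆? T →-dec (cycleIndependent? T →-dec T ⊆? S))

  -- VertexDisjoint is definitionally VertexDisjointLists on verts.
  VertexDisjointLists : List (Fin n) → List (Fin n) → Set
  VertexDisjointLists xs ys = ∀ v → v ∈ₗ xs → v ∈ₗ ys → ⊥

  packing? : ∀ k → Dec (∃[ Cs ] AllPairs (VertexDisjoint {G = G}) Cs × length Cs ≡ k)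
  packing? k = map′ (λ (Cs , p , l) → Cs , map⁻ p , l) (λ (Cs , p , l) → Cs , map⁺ p , l)
                    (anyCycles? k (allPairs? disjoint?))
    where
    disjoint? : ∀ xs ys → Dec (VertexDisjointLists xs ys)
    disjoint? xs ys = all? λ v → v ∈ₗ? xs →-dec (v ∈ₗ? ys →-dec no λ ())

  ∅-cycleIndependent : CycleIndependent G ∅
  ∅-cycleIndependent (C , v∈∅ ∷ _) = ∉⊥ v∈∅

  Escapes : Subset n → Cycle G → Set
  Escapes S C = ∃[ v ] OnCycle v C × v ∉ S

  cycleIndependent⇒escapes : ∀ {S} → CycleIndependent G S → ∀ C → Escapes S C
  cycleIndependent⇒escapes {S} indep C = find (¬All⇒Any¬ (_∈? S) (verts C) (λ C⊆S → indep (C , C⊆S)))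

  escapes-bound : ∀ {S Cs} → AllPairs VertexDisjoint Cs → All (Escapes S) Cs → ∣ S ∣ + length Cs ≤ n
  escapes-bound {S} [] [] = subst (_≤ n) (sym (+-identityʳ ∣ S ∣)) (∣p∣≤n S)
  escapes-bound {S} {C ∷ Cs} (C#Cs ∷ disjoint) ((v , v∈C , v∉S) ∷ escapes) = begin
    ∣ S ∣ + suc (length Cs)   ≡⟨ +-suc ∣ S ∣ (length Cs) ⟩
    suc ∣ S ∣ + length Cs     ≤⟨ +-monoˡ-≤ (length Cs) (x∉p⇒∣p∣<∣p∪⁅x⁆∣ v∉S) ⟩
    ∣ S ∪ ⁅ v ⁆ ∣ + length Cs ≤⟨ escapes-bound disjoint escapes′ ⟩
    n                         ∎
    where
    open ≤-Reasoning
    still-escapes : ∀ {D} → VertexDisjoint C D × Escapes S D → Escapes (S ∪ ⁅ v ⁆) D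
    still-escapes {D} (C#D , w , w∈D , w∉S) = w , w∈D , λ w∈S∪v →
      [ w∉S , (λ w∈⁅v⁆ → C#D v v∈C (subst (_∈ₗ verts D) (x∈⁅y⁆⇒x≡y v w∈⁅v⁆) w∈D)) ]′ (x∈p∪q⁻ S ⁅ v ⁆ w∈S∪v)
    escapes′ : All (Escapes (S ∪ ⁅ v ⁆)) Cs
    escapes′ = All.zipWith (λ {D} → still-escapes {D}) (C#Cs , escapes)

  independent+packing≤n : ∀ {S Cs} → CycleIndependent G S → AllPairs VertexDisjoint Cs →
                          ∣ S ∣ + length Cs ≤ n
  independent+packing≤n indep disjoint =
    escapes-bound disjoint (All.tabulate λ {C} _ → cycleIndependent⇒escapes indep C)

  acyclicVertices : Subset n
  acyclicVertices = subsetOf (¬? ∘ onCycle?)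

  isKappa : IsKappa G ∣ acyclicVertices ∣
  isKappa = acyclicVertices , (λ v → ∈-subsetOf⁻ (¬? ∘ onCycle?) , ∈-subsetOf⁺ (¬? ∘ onCycle?)) , refl

  maximum⇒maximal : ∀ {S} → CycleIndependent G S → (∀ T → CycleIndependent G T → ∣ T ∣ ≤ ∣ S ∣) →
                    MaximalCycleIndependent G S
  maximum⇒maximal indep max = indep , λ T S⊆T indepT → p⊆q∧∣q∣≤∣p∣⇒q⊆p S⊆T (max T indepT)

  maximal⇒cycle-through : ∀ {S v} → MaximalCycleIndependent G S → v ∉ S →
                          ∃[ C ] OnCycle v C × All (_∈ S ∪ ⁅ v ⁆) (verts C)
  maximal⇒cycle-through {S} {v} (indep , max) v∉S
    with anyCycle? (All.all? (_∈? S ∪ ⁅ v ⁆))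
  ... | no ∄C = contradiction (max (S ∪ ⁅ v ⁆) (p⊆p∪q ⁅ v ⁆) ∄C (x∈p∪q⁺ (inj₂ (x∈⁅x⁆ v)))) v∉S
  ... | yes (C , C⊆S∪v) with v ∈ₗ? verts C
  ...   | yes v∈C = C , v∈C , C⊆S∪v
  ...   | no  v∉C = contradiction (C , All-∈p∪⁅x⁆⇒All-∈p v∉C C⊆S∪v) indep

  acyclicVertices⊆maximal : ∀ {S} → MaximalCycleIndependent G S → acyclicVertices ⊆ S
  acyclicVertices⊆maximal {S} maximal {v} v∈K with v ∈? S
  ... | yes v∈S = v∈S
  ... | no  v∉S with maximal⇒cycle-through maximal v∉S
  ...   | C , v∈C , _ = contradiction (C , v∈C) (∈-subsetOf⁻ (¬? ∘ onCycle?) v∈K)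

  acyclic+len≤1+maximal : ∀ {S} → MaximalCycleIndependent G S → Cycle G →
                          ∃[ C ] ∣ acyclicVertices ∣ + len C ≤ suc ∣ S ∣
  acyclic+len≤1+maximal {S} maximal@(indep , _) C₀ with cycleIndependent⇒escapes indep C₀
  ... | v , _ , v∉S with maximal⇒cycle-through maximal v∉S
  ...   | C , _ , C⊆S∪v = C , ≤-trans (unique-count K⊆S∪v (distinct C) C⊆S∪v C∩K=∅) (∣p∪⁅x⁆∣≤1+∣p∣ S v)
    where
    K⊆S∪v : acyclicVertices ⊆ S ∪ ⁅ v ⁆
    K⊆S∪v = p⊆p∪q ⁅ v ⁆ ∘ acyclicVertices⊆maximal maximal
    C∩K=∅ : All (_∉ acyclicVertices) (verts C)
    C∩K=∅ = All.tabulate λ w∈C w∈K → ∈-subsetOf⁻ (¬? ∘ onCycle?) w∈K (C , w∈C)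

  girth∸1+κ≤maximal : ∀ {g S} → IsGirth G g → MaximalCycleIndependent G S → g ∸ 1 + ∣ acyclicVertices ∣ ≤ ∣ S ∣
  girth∸1+κ≤maximal (inj₁ (_ , refl)) maximal = p⊆q⇒∣p∣≤∣q∣ (acyclicVertices⊆maximal maximal)
  girth∸1+κ≤maximal (inj₂ ((C₀ , _) , shortest)) maximal with acyclic+len≤1+maximal maximal C₀
  ... | C , bound = arith (shortest C) bound
    where
    arith : ∀ {g k l s} → g ≤ suc l → k + suc l ≤ suc s → g ∸ 1 + k ≤ s
    arith {g} {k} {l} {s} g≤1+l k+1+l≤1+s = begin
      g ∸ 1 + k ≤⟨ +-monoˡ-≤ k (∸-monoˡ-≤ 1 g≤1+l) ⟩
      l + k     ≡⟨ +-comm l k ⟩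
      k + l     ≤⟨ s≤s⁻¹ (subst (_≤ suc s) (+-suc k l) k+1+l≤1+s) ⟩
      s         ∎
      where open ≤-Reasoning

  girth : ∃[ g ] IsGirth G g
  girth with anyCycle? {P = λ _ → ⊤} (λ _ → yes tt)
  ... | no ∄C = 1 , inj₁ ((λ C → ∄C (C , tt)) , refl)
  ... | yes (C , _) with least (λ k → anyCycle? (λ xs → length xs ≟ℕ k)) (C , refl)
  ...   | g , shortest , g≤ = g , inj₂ (shortest , λ D → g≤ (D , refl))

  maximumIndependent : ∃[ S ] CycleIndependent G S × (∀ T → CycleIndependent G T → ∣ T ∣ ≤ ∣ S ∣)
  maximumIndependent = maximumSize cycleIndependent? (∅ , ∅-cycleIndependent)

  minimumMaximal : ∃[ S ] MaximalCycleIndependent G S × (∀ T → MaximalCycleIndependent G T → ∣ S ∣ ≤ ∣ T ∣)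
  minimumMaximal with maximumIndependent
  ... | S , indep , max = minimumSize maximalCycleIndependent? (S , maximum⇒maximal indep max)

  tau : ∃[ t ] IsTau G t
  tau with greatest packing? n packing≤n ([] , [] , refl)
    where
    packing≤n : ∀ {k} → ∃[ Cs ] AllPairs VertexDisjoint Cs × length Cs ≡ k → k ≤ n
    packing≤n (Cs , disjoint , refl) =
      subst (_≤ n) (cong (_+ length Cs) (∣⊥∣≡0 n)) (independent+packing≤n ∅-cycleIndependent disjoint)
  ... | t , packing , max = t , packing , λ Cs disjoint → max (Cs , disjoint , refl)

mainTheorem3 : ∀ {n : ℕ} (G : Graph n) →
    ∃[ g ] ∃[ κ ] ∃[ i ] ∃[ β ] ∃[ t ]
      (IsGirth G g × IsKappa G κ × IsICy G i × IsBetaCy G β × IsTau G t ×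
       (g ∸ 1 + κ ≤ i) × (i ≤ β) × (β ≤ n ∸ t))
mainTheorem3 G with girth G | maximumIndependent G | minimumMaximal G | tau G
... | g , isGirth | B , indepB , maxB | I , maximalI@(indepI , _) , minI | _ , ((Cs , disjoint , refl) , maxCs) =
  g , ∣ acyclicVertices G ∣ , ∣ I ∣ , ∣ B ∣ , length Cs ,
  isGirth , isKappa G , ((I , maximalI , refl) , minI) , ((B , indepB , refl) , maxB) ,
  ((Cs , disjoint , refl) , maxCs) ,
  girth∸1+κ≤maximal G isGirth maximalI ,
  maxB I indepI ,
  m+n≤o⇒m≤o∸n ∣ B ∣ (independent+packing≤n G indepB disjoint)
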